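{- For any bipartition $(L,R)$ of a finite set $A\subset\mathbb{Z}_{>0}$, there exists an elementary interval bipartition $(L',R')$ such that $\boldsymbol{\lambda}(L,R)=\boldsymbol{\lambda}(L',R')$.
   Context: A bipartition of a set $A$ is an ordered pair $(L,R)$ with $L\cup R=A$ and $L\cap R=\varnothing$. An interval bipartition is a bipartition of an interval $\{a,a+1,\dots,b\}$ of $\mathbb{Z}_{>0}$. It is elementary if either $L=R=\varnothing$, or both $1\in L$ and $\max(L\cup R)\in R$. For a bipartition $(L,R)$ of a finite set: if $L=\varnothing$ put $\boldsymbol{\lambda}(L,R)=(0)$; otherwise write $L=\{\ell_1<\dots<\ell_p\}$ and let $\boldsymbol{\lambda}(L,R)$ be the weakly decreasing sequence with $\boldsymbol{\lambda}(L,R)_i=\#\{r\in R:\ell_i<r\}$ for $1\leqslant i\leqslant p$. Integer partitions are identified up to zero parts (so e.g. $(2,0)=(2)$ and $(0,0)=(0)$). -}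

module Defs where

open import Data.Nat using (ℕ; zero; suc; _≤_; _<_; _<?_; _≟_)
open import Data.List using (List; []; _∷_; map; filter; length; _++_)
open import Data.List.Membership.Propositional using (_∈_; _∉_)
open import Data.List.Relation.Unary.All using (All)
open import Data.List.Relation.Unary.Linked using (Linked)
open import Data.Product using (_×_; ∃; ∃-syntax)
open import Data.Sum using (_⊎_)
open import Relation.Binary.PropositionalEquality using (_≡_)
open import Relation.Nullary using (¬_; ¬?)
open import Function.Bundles using (_⇔_)

-- A finite subset of ℤ_{>0} is represented canonically by the strictly
-- increasing list of its elements, all positive.
record FinPosSet (S : List ℕ) : Set where
  field
    increasing : Linked _<_ S
    positive   : All (λ x → 0 < x) S

record Bipartition (L R : List ℕ) : Set where
  field
    finL     : FinPosSet L
    finR     : FinPosSet R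
    disjoint : All (λ x → x ∉ R) L

-- (L , R) is a bipartition of an interval {a, a+1, …, b} of ℤ_{>0}
-- (a > b gives the empty interval).
IntervalBipartition : List ℕ → List ℕ → Set
IntervalBipartition L R =
  Bipartition L R ×
  ∃[ a ] ∃[ b ] (1 ≤ a × (∀ x → (x ∈ L ⊎ x ∈ R) ⇔ (a ≤ x × x ≤ b)))

Elementary : List ℕ → List ℕ → Set
Elementary L R =
  (L ≡ [] × R ≡ []) ⊎
  (1 ∈ L × ∃[ m ] (m ∈ R × All (λ x → x ≤ m) (L ++ R)))

lam : List ℕ → List ℕ → List ℕ
lam [] R = 0 ∷ []
lam L@(_ ∷ _) R = map (λ ℓ → length (filter (ℓ <?_) R)) L

-- Integer partitions are identified up to zero parts.
dropZeros : List ℕ → List ℕ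
dropZeros = filter (λ n → ¬? (n ≟ 0))

_≈ₚ_ : List ℕ → List ℕ → Set
p ≈ₚ q = dropZeros p ≡ dropZeros q

-- Record A = L ∪ R, read in increasing order, as a word in the letters L and R.
-- λ(L,R) only depends on this word: its parts are, for each L-letter, the
-- number of R-letters to its right.  Cutting off the final block of L-letters
-- only deletes zero parts, and cutting off the initial block of R-letters
-- changes nothing.  The trimmed word begins with L and ends with R (or is
-- empty), so laying it out on {1, …, n} gives an elementary interval
-- bipartition with the same λ.
module Submission where

open import Defs
open import Data.Nat using (ℕ; zero; suc; _+_; _≤_; _<_; _<?_; s≤s)
open import Data.Nat.Properties
open import Data.List using (List; []; _∷_; map; filter; length)
open import Data.List.Properties using (filter-all; filter-reject; map-cong-local)
open import Data.List.Relation.Unary.All as All using (All; []; _∷_)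
open import Data.List.Relation.Unary.All.Properties using (++⁺)
open import Data.List.Relation.Unary.AllPairs using (AllPairs; []; _∷_)
open import Data.List.Relation.Unary.Any using (here; there)
open import Data.List.Relation.Unary.Linked.Properties using (AllPairs⇒Linked; Linked⇒AllPairs)
open import Data.List.Membership.Propositional using (_∈_; _∉_)
open import Data.Product using (_×_; _,_; ∃-syntax)
open import Data.Sum using (_⊎_; inj₁; inj₂)
open import Data.Empty using (⊥-elim)
open import Relation.Nullary using (¬_; Dec; yes; no)
open import Relation.Binary.Definitions using (DecidableEquality)
open import Relation.Binary.PropositionalEquality
open import Function.Bundles using (_⇔_; mk⇔)

data Side : Set where
  inL inR : Side

_≟ˢ_ : DecidableEquality Side
inL ≟ˢ inL = yes refl
inL ≟ˢ inR = no λ ()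
inR ≟ˢ inL = no λ ()
inR ≟ˢ inR = yes refl

Word : Set
Word = List Side

count : Side → Word → ℕ
count s [] = 0
count s (t ∷ w) with t ≟ˢ s
... | yes _ = suc (count s w)
... | no _ = count s w

shape : Word → List ℕ
shape [] = []
shape (inL ∷ w) = count inR w ∷ shape w
shape (inR ∷ w) = shape w

rightsAbove : ℕ → List ℕ → ℕ
rightsAbove ℓ R = length (filter (ℓ <?_) R)

lamMap : List ℕ → List ℕ → List ℕ
lamMap L R = map (λ ℓ → rightsAbove ℓ R) L

lam≈ₚlamMap : ∀ L R → lam L R ≈ₚ lamMap L R
lam≈ₚlamMap [] R = refl
lam≈ₚlamMap (_ ∷ _) R = refl

rightsAbove-all : ∀ {ℓ R} → All (ℓ <_) R → rightsAbove ℓ R ≡ length R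
rightsAbove-all {ℓ} ℓ<R = cong length (filter-all (ℓ <?_) ℓ<R)

rightsAbove-skip : ∀ {ℓ r} R → r ≤ ℓ → rightsAbove ℓ (r ∷ R) ≡ rightsAbove ℓ R
rightsAbove-skip {ℓ} R r≤ℓ = cong length (filter-reject (ℓ <?_) (≤⇒≯ r≤ℓ))

∷-cong-≈ₚ : ∀ {m n p q} → m ≡ n → p ≈ₚ q → (m ∷ p) ≈ₚ (n ∷ q)
∷-cong-≈ₚ {zero} refl p≈q = p≈q
∷-cong-≈ₚ {suc m} refl p≈q = cong (suc m ∷_) p≈q

-- Branching through pickSide instead of `with l <? r` keeps the lexicographic
-- descent of toWord and its lemmas visible to the termination checker.
pickSide : ∀ {P : Set} → Dec P → Word → Word → Word
pickSide (yes _) afterL _ = inL ∷ afterL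
pickSide (no _) _ afterR = inR ∷ afterR

toWord : List ℕ → List ℕ → Word
toWord [] [] = []
toWord [] (r ∷ R) = inR ∷ toWord [] R
toWord (l ∷ L) [] = inL ∷ toWord L []
toWord (l ∷ L) (r ∷ R) = pickSide (l <? r) (toWord L (r ∷ R)) (toWord (l ∷ L) R)

pickSide-elim : ∀ {P : Set} (Q : Word → Set) (d : Dec P) {afterL afterR} →
  (P → Q (inL ∷ afterL)) → (¬ P → Q (inR ∷ afterR)) → Q (pickSide d afterL afterR)
pickSide-elim Q (yes p) onL _ = onL p
pickSide-elim Q (no ¬p) _ onR = onR ¬p

count-toWord : ∀ L R → count inR (toWord L R) ≡ length R
count-toWord [] [] = refl
count-toWord [] (r ∷ R) = cong suc (count-toWord [] R)
count-toWord (l ∷ L) [] = count-toWord L []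
count-toWord (l ∷ L) (r ∷ R) =
  pickSide-elim (λ v → count inR v ≡ length (r ∷ R)) (l <? r)
    (λ _ → count-toWord L (r ∷ R)) (λ _ → cong suc (count-toWord (l ∷ L) R))

shape-toWord : ∀ {L R} → AllPairs _<_ L → AllPairs _<_ R → lamMap L R ≡ shape (toWord L R)
shape-toWord {[]} {[]} _ _ = refl
shape-toWord {[]} {r ∷ R} [] (_ ∷ R↑) = shape-toWord [] R↑
shape-toWord {l ∷ L} {[]} (_ ∷ L↑) [] = cong₂ _∷_ (sym (count-toWord L [])) (shape-toWord L↑ [])
shape-toWord {l ∷ L} {r ∷ R} (l<L ∷ L↑) (r<R ∷ R↑) =
  pickSide-elim (λ v → lamMap (l ∷ L) (r ∷ R) ≡ shape v) (l <? r)
    (λ l<r → cong₂ _∷_ (l-count l<r) (shape-toWord L↑ (r<R ∷ R↑)))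
    (λ l≮r → trans (map-cong-local (r-skipped (≮⇒≥ l≮r))) (shape-toWord (l<L ∷ L↑) R↑))
  where
  l-count : l < r → rightsAbove l (r ∷ R) ≡ count inR (toWord L (r ∷ R))
  l-count l<r = trans (rightsAbove-all (l<r ∷ All.map (<-trans l<r) r<R))
                      (sym (count-toWord L (r ∷ R)))
  r-skipped : r ≤ l → All (λ ℓ → rightsAbove ℓ (r ∷ R) ≡ rightsAbove ℓ R) (l ∷ L)
  r-skipped r≤l = rightsAbove-skip R r≤l
                ∷ All.map (λ l<ℓ → rightsAbove-skip R (≤-trans r≤l (<⇒≤ l<ℓ))) l<L

data EndsInR : Word → Set where
  [inR] : EndsInR (inR ∷ [])
  _∷_ : ∀ s {w} → EndsInR w → EndsInR (s ∷ w)

data ElementaryWord : Word → Set where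
  [] : ElementaryWord []
  inL∷_ : ∀ {w} → EndsInR w → ElementaryWord (inL ∷ w)

dropTrailingL : Word → Word
dropTrailingL [] = []
dropTrailingL (inR ∷ w) = inR ∷ dropTrailingL w
dropTrailingL (inL ∷ w) with count inR w
... | zero = []
... | suc _ = inL ∷ dropTrailingL w

dropLeadingR : Word → Word
dropLeadingR [] = []
dropLeadingR (inL ∷ w) = inL ∷ w
dropLeadingR (inR ∷ w) = dropLeadingR w

trim : Word → Word
trim w = dropLeadingR (dropTrailingL w)

count-dropTrailingL : ∀ w → count inR (dropTrailingL w) ≡ count inR w
count-dropTrailingL [] = refl
count-dropTrailingL (inR ∷ w) = cong suc (count-dropTrailingL w)
count-dropTrailingL (inL ∷ w) with count inR w in eq
... | zero = refl
... | suc _ = trans (count-dropTrailingL w) eq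

shape-noR : ∀ w → count inR w ≡ 0 → shape w ≈ₚ []
shape-noR [] _ = refl
shape-noR (inL ∷ w) noR rewrite noR = shape-noR w noR

shape-dropTrailingL : ∀ w → shape (dropTrailingL w) ≈ₚ shape w
shape-dropTrailingL [] = refl
shape-dropTrailingL (inR ∷ w) = shape-dropTrailingL w
shape-dropTrailingL (inL ∷ w) with count inR w in eq
... | zero = sym (shape-noR w eq)
... | suc _ = ∷-cong-≈ₚ {p = shape (dropTrailingL w)} {q = shape w} (trans (count-dropTrailingL w) eq)
                                                  (shape-dropTrailingL w)

inR∷-endsInR : ∀ {w} → w ≡ [] ⊎ EndsInR w → EndsInR (inR ∷ w)
inR∷-endsInR (inj₁ refl) = [inR]
inR∷-endsInR (inj₂ e) = inR ∷ e

dropTrailingL-endsInR : ∀ w → dropTrailingL w ≡ [] ⊎ EndsInR (dropTrailingL w)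
dropTrailingL-endsInR [] = inj₁ refl
dropTrailingL-endsInR (inR ∷ w) = inj₂ (inR∷-endsInR (dropTrailingL-endsInR w))
dropTrailingL-endsInR (inL ∷ w) with count inR w in eq
... | zero = inj₁ refl
... | suc _ with dropTrailingL-endsInR w
...   | inj₂ e = inj₂ (inL ∷ e)
...   | inj₁ empty with () ← trans (sym (cong (count inR) empty))
                                   (trans (count-dropTrailingL w) eq)

shape-dropLeadingR : ∀ w → shape (dropLeadingR w) ≡ shape w
shape-dropLeadingR [] = refl
shape-dropLeadingR (inL ∷ w) = refl
shape-dropLeadingR (inR ∷ w) = shape-dropLeadingR w

dropLeadingR-elementary : ∀ {w} → w ≡ [] ⊎ EndsInR w → ElementaryWord (dropLeadingR w)
dropLeadingR-elementary (inj₁ refl) = []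
dropLeadingR-elementary (inj₂ [inR]) = []
dropLeadingR-elementary (inj₂ (inR ∷ e)) = dropLeadingR-elementary (inj₂ e)
dropLeadingR-elementary (inj₂ (inL ∷ e)) = inL∷ e

trim-elementary : ∀ w → ElementaryWord (trim w)
trim-elementary w = dropLeadingR-elementary (dropTrailingL-endsInR w)

shape-trim : ∀ w → shape (trim w) ≈ₚ shape w
shape-trim w = trans (cong dropZeros (shape-dropLeadingR (dropTrailingL w)))
                     (shape-dropTrailingL w)

positions : Side → ℕ → Word → List ℕ
positions s k [] = []
positions s k (t ∷ w) with t ≟ˢ s
... | yes _ = k ∷ positions s (suc k) w
... | no _ = positions s (suc k) w

positions-≥ : ∀ {s} k w → All (k ≤_) (positions s k w)
positions-≥ k [] = []
positions-≥ {s} k (t ∷ w) with t ≟ˢ s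
... | yes _ = ≤-refl ∷ All.map <⇒≤ (positions-≥ (suc k) w)
... | no _ = All.map <⇒≤ (positions-≥ (suc k) w)

positions-< : ∀ {s} k w → All (_< k + length w) (positions s k w)
positions-< k [] = []
positions-< {s} k (t ∷ w) rewrite +-suc k (length w) with t ≟ˢ s
... | yes _ = s≤s (m≤m+n k (length w)) ∷ positions-< (suc k) w
... | no _ = positions-< (suc k) w

positions-increasing : ∀ {s} k w → AllPairs _<_ (positions s k w)
positions-increasing k [] = []
positions-increasing {s} k (t ∷ w) with t ≟ˢ s
... | yes _ = positions-≥ (suc k) w ∷ positions-increasing (suc k) w
... | no _ = positions-increasing (suc k) w

length-positions : ∀ {s} k w → length (positions s k w) ≡ count s w
length-positions k [] = refl
length-positions {s} k (t ∷ w) with t ≟ˢ s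
... | yes _ = cong suc (length-positions (suc k) w)
... | no _ = length-positions (suc k) w

∉-positions-suc : ∀ {s} k w → k ∉ positions s (suc k) w
∉-positions-suc k w k∈ = <-irrefl refl (All.lookup (positions-≥ (suc k) w) k∈)

positions-∷⁺ : ∀ {s k x} t w → x ∈ positions s (suc k) w → x ∈ positions s k (t ∷ w)
positions-∷⁺ {s} t w x∈ with t ≟ˢ s
... | yes _ = there x∈
... | no _ = x∈

positions-head : ∀ t k w → k ∈ positions t k (t ∷ w)
positions-head t k w with t ≟ˢ t
... | yes _ = here refl
... | no t≢t = ⊥-elim (t≢t refl)

positions-unique : ∀ {s t k x} w → x ∈ positions s k w → x ∈ positions t k w → s ≡ t
positions-unique {s} {t} {k} (u ∷ w) x∈s x∈t with u ≟ˢ s | u ≟ˢ t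
... | yes refl | yes refl = refl
... | no _ | no _ = positions-unique w x∈s x∈t
... | yes _ | no _ with x∈s
...   | here refl = ⊥-elim (∉-positions-suc k w x∈t)
...   | there x∈s′ = positions-unique w x∈s′ x∈t
positions-unique {s} {t} {k} (u ∷ w) x∈s x∈t | no _ | yes _ with x∈t
...   | here refl = ⊥-elim (∉-positions-suc k w x∈s)
...   | there x∈t′ = positions-unique w x∈s x∈t′

positions-cover : ∀ {k x} w → k ≤ x → x < k + length w → ∃[ s ] x ∈ positions s k w
positions-cover {k} [] k≤x x<k+0 =
  ⊥-elim (<-irrefl (sym (+-identityʳ k)) (≤-<-trans k≤x x<k+0))
positions-cover {k} {x} (t ∷ w) k≤x x<end with m≤n⇒m<n∨m≡n k≤x
... | inj₂ refl = t , positions-head t k w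
... | inj₁ k<x with positions-cover w k<x (subst (x <_) (+-suc k (length w)) x<end)
...   | s , x∈ = s , positions-∷⁺ t w x∈

lamMap-positions : ∀ k w → lamMap (positions inL k w) (positions inR k w) ≡ shape w
lamMap-positions k [] = refl
lamMap-positions k (inL ∷ w) = cong₂ _∷_ k-count (lamMap-positions (suc k) w)
  where
  k-count : rightsAbove k (positions inR (suc k) w) ≡ count inR w
  k-count = trans (rightsAbove-all (positions-≥ (suc k) w)) (length-positions (suc k) w)
lamMap-positions k (inR ∷ w) =
  trans (map-cong-local (All.map (λ k<ℓ → rightsAbove-skip _ (<⇒≤ k<ℓ)) (positions-≥ (suc k) w)))
        (lamMap-positions (suc k) w)

endsInR-last : ∀ {w} k → EndsInR w → k + length w ∈ positions inR (suc k) w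
endsInR-last k [inR] = here (+-comm k 1)
endsInR-last {s ∷ w} k (s ∷ e) =
  subst (_∈ positions inR (suc k) (s ∷ w)) (sym (+-suc k (length w)))
        (positions-∷⁺ s w (endsInR-last (suc k) e))

lefts rights : Word → List ℕ
lefts = positions inL 1
rights = positions inR 1

positions-≤ : ∀ {s} w → All (_≤ length w) (positions s 1 w)
positions-≤ w = All.map ≤-pred (positions-< 1 w)

positions-bipartition : ∀ w → Bipartition (lefts w) (rights w)
positions-bipartition w = record
  { finL = record { increasing = AllPairs⇒Linked (positions-increasing 1 w)
                  ; positive = positions-≥ 1 w }
  ; finR = record { increasing = AllPairs⇒Linked (positions-increasing 1 w)
                  ; positive = positions-≥ 1 w }
  ; disjoint = All.tabulate λ x∈L x∈R → inL≢inR (positions-unique w x∈L x∈R)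
  }
  where
  inL≢inR : ¬ inL ≡ inR
  inL≢inR ()

positions-interval : ∀ w x → (x ∈ lefts w ⊎ x ∈ rights w) ⇔ (1 ≤ x × x ≤ length w)
positions-interval w x = mk⇔ in-interval from-interval
  where
  in-interval : x ∈ lefts w ⊎ x ∈ rights w → 1 ≤ x × x ≤ length w
  in-interval (inj₁ x∈) = All.lookup (positions-≥ 1 w) x∈ , All.lookup (positions-≤ w) x∈
  in-interval (inj₂ x∈) = All.lookup (positions-≥ 1 w) x∈ , All.lookup (positions-≤ w) x∈
  from-interval : 1 ≤ x × x ≤ length w → x ∈ lefts w ⊎ x ∈ rights w
  from-interval (1≤x , x≤n) with positions-cover w 1≤x (s≤s x≤n)
  ... | inL , x∈ = inj₁ x∈
  ... | inR , x∈ = inj₂ x∈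

positions-elementary : ∀ {w} → ElementaryWord w → Elementary (lefts w) (rights w)
positions-elementary [] = inj₁ (refl , refl)
positions-elementary {w} (inL∷ e) =
  inj₂ (here refl , length w , endsInR-last 0 (inL ∷ e) , ++⁺ (positions-≤ {inL} w) (positions-≤ {inR} w))

lemma3p10 : (L R : List ℕ) → Bipartition L R →
    ∃[ L′ ] ∃[ R′ ] (IntervalBipartition L′ R′ × Elementary L′ R′ × lam L R ≈ₚ lam L′ R′)
lemma3p10 L R bp =
  lefts u , rights u ,
  (positions-bipartition u , 1 , length u , ≤-refl , positions-interval u) ,
  positions-elementary (trim-elementary w) , same-lam
  where
  open Bipartition bp
  w = toWord L R
  u = trim w
  same-lam : lam L R ≈ₚ lam (lefts u) (rights u)
  same-lam = begin
    dropZeros (lam L R)                           ≡⟨ lam≈ₚlamMap L R ⟩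
    dropZeros (lamMap L R)                        ≡⟨ cong dropZeros (shape-toWord (sorted finL) (sorted finR)) ⟩
    dropZeros (shape w)                           ≡⟨ sym (shape-trim w) ⟩
    dropZeros (shape u)                           ≡⟨ cong dropZeros (sym (lamMap-positions 1 u)) ⟩
    dropZeros (lamMap (lefts u) (rights u))       ≡⟨ sym (lam≈ₚlamMap (lefts u) (rights u)) ⟩
    dropZeros (lam (lefts u) (rights u))          ∎
    where
    open ≡-Reasoning
    sorted : ∀ {S} → FinPosSet S → AllPairs _<_ S
    sorted S = Linked⇒AllPairs <-trans (FinPosSet.increasing S)
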